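{- Let $T^*$ be an optimal solution of a $\delta$-large UFP instance satisfying the standing assumptions below, and let $L=\{\ell(i): i\in T^*\}$. If $L'\subseteq L$ is $k$-thin for $L$, then the maze pair $(T(L'),M(L'))$ is $(k+1/\delta)$-thin and $T(L')\cup M(L')$ is feasible, i.e. $d(T(L')\cap T_e)+d(M(L')\cap M_e)\le u_e$ for every edge $e$.
   Context: A UFP instance: a path with vertices $1,\dots,n$ from left to right, edges $e=(v,v+1)$ with capacities $u_e\in\mathbb{Z}_{>0}$, and a finite set $T$ of tasks, each task $i$ having a subpath $P(i)$ from $s(i)$ to $t(i)$, demand $d(i)>0$, profit $w(i)\ge0$. $T_e=\{i:e\in P(i)\}$; $w(S),d(S)$ denote sums. Feasible: $d(S\cap T_e)\le u_e$ for all $e$; optimal: feasible with maximum profit. $b(i)=\min_{e\in P(i)}u_e$, $e(i)$ the edge of $P(i)$ with capacity $b(i)$. $\delta\in(0,1]$; a task is $\delta$-large if $d(i)\ge\delta b(i)$. Standing assumptions: edge capacities pairwise distinct, $d(i)\le b(i)$, every vertex is start or end vertex of exactly one task. M-tasks: for each pair of tasks $i,j$ (possibly equal) with $e(i)=e(j)=e$, an m-task $m$ with $P(m)=P(i)\cup P(j)$, $b(m)=u_e$, $e(m)=e$, $d(m)=\delta u_e$, profit 0; $M$ = all m-tasks, $M_e=\{m:e\in P(m)\}$. A maze pair $(T',M')$: $T'\subseteq T$, $M'\subseteq M$, distinct elements of $M'$ with distinct bottleneck capacities; it is $k$-thin if for every edge $e$ and every $T''\subseteq T'\cap T_e$ with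 $|T''|>k$ there is $m\in M'\cap M_e$ with $\min_{i\in T''}b(i)\le b(m)<\max_{i\in T''}b(i)$. Segments: for task $i$, $\ell(i)=(s(i),t(i))\times\{b(i)\}\subseteq\mathbb{R}^2$ (open horizontal segment), with weight $w(\ell(i))=w(i)$. A vertical segment $\{x\}\times(y_b,y_t)$ intersects a horizontal segment $(a,b)\times\{y\}$ if $a<x<b$ and $y_b<y<y_t$. A set $L'\subseteq L$ is $k$-thin for $L$ if every vertical segment intersecting more than $k$ segments of $L$ intersects at least one segment of $L'$. Given $L'\subseteq L$: $T(L')=\{i\in T^*:\ell(i)\notin L'\}$; for each edge $e$ let $L'_e=\{\ell(i)\in L': e(i)=e\}$, and for each $e$ with $L'_e\ne\emptyset$ let $m_e$ be the m-task with $P(m_e)=P(i_L)\cup P(i_R)$, where $i_L$ is the task of $L'_e$ with leftmost start vertex and $i_R$ the one with rightmost end vertex; $M(L')=\{m_e: L'_e\ne\emptyset\}$.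
   Formalization: The demands $d(i)$, the profits $w(i)$ and the parameter $\delta$ are rational. -}

module Defs where

open import Data.Bool using (Bool; true; false; _∧_; _∨_; not; if_then_else_)
open import Data.Nat as ℕ using (ℕ; zero; suc; _∸_; _⊓_; _<ᵇ_; _≤ᵇ_; _≡ᵇ_)
open import Data.Integer using (+_)
open import Data.Rational as ℚ using (ℚ; 0ℚ; 1ℚ; _/_; 1/_; _+_; _*_)
open import Data.Rational.Properties using (_<?_; pos⇒nonZero)
open import Data.Fin using (Fin; zero; suc)
open import Data.Maybe using (Maybe; just; nothing)
import Data.Maybe as Maybe
open import Data.Product using (Σ; _×_; _,_; ∃)
open import Relation.Nullary.Decidable using (⌊_⌋)
open import Relation.Binary.PropositionalEquality using (_≡_)

ℕ→ℚ : ℕ → ℚ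
ℕ→ℚ n = + n / 1

inv : (δ : ℚ) → ℚ.Positive δ → ℚ
inv δ p = (1/ δ) {{pos⇒nonZero δ {{p}}}}

sumFin : ∀ {m} → (Fin m → ℚ) → ℚ
sumFin {zero}  f = 0ℚ
sumFin {suc m} f = f zero + sumFin (λ i → f (suc i))

card : ∀ {m} → (Fin m → Bool) → ℕ
card {zero}  S = 0
card {suc m} S = (if S zero then 1 else 0) ℕ.+ card (λ i → S (suc i))

sumRange : ℕ → ℕ → (ℕ → ℚ) → ℚ
sumRange a zero      f = 0ℚ
sumRange a (suc len) f = f a + sumRange (suc a) len f

argBest : ∀ {m} → (Fin m → Bool) → (Fin m → Fin m → Bool) → Maybe (Fin m)
argBest {zero}  S better = nothing
argBest {suc m} S better =
  combine (S zero) (Maybe.map suc (argBest (λ i → S (suc i)) (λ i j → better (suc i) (suc j))))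
  where
  combine : Bool → Maybe (Fin (suc m)) → Maybe (Fin (suc m))
  combine false r        = r
  combine true  nothing  = just zero
  combine true  (just j) = if better j zero then just j else just zero

-- minimum of u over the edges a, a+1, ..., a+len-1  (len ≥ 1 intended)
minCap : (ℕ → ℕ) → ℕ → ℕ → ℕ
minCap u a zero            = 0
minCap u a (suc zero)      = u a
minCap u a (suc (suc len)) = u a ⊓ minCap u (suc a) (suc len)

-- UFP instances on a path with vertices 1..n.
-- Edge e = (e, e+1) is identified with its left vertex e, 1 ≤ e < n.
-- Tasks are indexed by Fin m.

record UFP : Set where
  field
    n : ℕ
    m : ℕ
    u : ℕ → ℕ          -- capacity of edge (e, e+1), relevant for 1 ≤ e < n
    s t : Fin m → ℕ
    d w : Fin m → ℚ

module _ (I : UFP) where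
  open UFP I

  IsEdge : ℕ → Set
  IsEdge e = 1 ℕ.≤ e × e ℕ.< n

  inP : Fin m → ℕ → Bool
  inP i e = (s i ≤ᵇ e) ∧ (e <ᵇ t i)

  b : Fin m → ℕ
  b i = minCap u (s i) (t i ∸ s i)

  isBottleneck : Fin m → ℕ → Bool
  isBottleneck i e = inP i e ∧ (u e ≡ᵇ b i)

  demandOn : (Fin m → Bool) → ℕ → ℚ
  demandOn S e = sumFin (λ i → if S i ∧ inP i e then d i else 0ℚ)

  profit : (Fin m → Bool) → ℚ
  profit S = sumFin (λ i → if S i then w i else 0ℚ)

  Feasible : (Fin m → Bool) → Set
  Feasible S = ∀ e → IsEdge e → demandOn S e ℚ.≤ ℕ→ℚ (u e)

  Optimal : (Fin m → Bool) → Set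
  Optimal S = Feasible S × (∀ S' → Feasible S' → profit S' ℚ.≤ profit S)

  endpoint : Fin m × Bool → ℕ
  endpoint (i , true)  = s i
  endpoint (i , false) = t i

  record Standing : Set where
    field
      cap-pos      : ∀ e → IsEdge e → 0 ℕ.< u e
      cap-distinct : ∀ e e' → IsEdge e → IsEdge e' → u e ≡ u e' → e ≡ e'
      s-pos        : ∀ i → 1 ℕ.≤ s i
      s<t          : ∀ i → s i ℕ.< t i
      t≤n          : ∀ i → t i ℕ.≤ n
      d-pos        : ∀ i → 0ℚ ℚ.< d i
      w-nonneg     : ∀ i → 0ℚ ℚ.≤ w i
      d≤b          : ∀ i → d i ℚ.≤ ℕ→ℚ (b i)
      endpoint-unique : ∀ v → 1 ℕ.≤ v → v ℕ.≤ n →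
                        Σ (Fin m × Bool) λ p → endpoint p ≡ v × (∀ q → endpoint q ≡ v → q ≡ p)

  DeltaLarge : ℚ → Set
  DeltaLarge δ = ∀ i → δ * ℕ→ℚ (b i) ℚ.≤ d i

  -- Segments ℓ(i) = (s(i), t(i)) × {b(i)}; subsets of L = {ℓ(i) : i ∈ T*}
  -- are given by the set of tasks i ∈ T* whose segment they contain
  -- (distinct tasks have distinct start vertices, hence distinct segments).

  -- the vertical segment {x} × (yb, yt) intersects ℓ(i)
  intersects : ℚ → ℚ → ℚ → Fin m → Bool
  intersects x yb yt i =
    ⌊ ℕ→ℚ (s i) <? x ⌋ ∧ ⌊ x <? ℕ→ℚ (t i) ⌋ ∧ ⌊ yb <? ℕ→ℚ (b i) ⌋ ∧ ⌊ ℕ→ℚ (b i) <? yt ⌋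

  SegThin : ℕ → (Tstar L' : Fin m → Bool) → Set
  SegThin k Tstar L' = ∀ (x yb yt : ℚ) →
    k ℕ.< card (λ i → Tstar i ∧ intersects x yb yt i) →
    ∃ λ i → L' i ≡ true × intersects x yb yt i ≡ true

  TL : (Tstar L' : Fin m → Bool) → Fin m → Bool
  TL Tstar L' i = Tstar i ∧ not (L' i)

  Le : (L' : Fin m → Bool) → ℕ → Fin m → Bool
  Le L' e i = L' i ∧ isBottleneck i e

  iL : (L' : Fin m → Bool) → ℕ → Maybe (Fin m)
  iL L' e = argBest (Le L' e) (λ i j → s i <ᵇ s j)

  iR : (L' : Fin m → Bool) → ℕ → Maybe (Fin m)
  iR L' e = argBest (Le L' e) (λ i j → t j <ᵇ t i)

  -- M(L') = { m_e : L'_e ≠ ∅ }; the m-task m_e is indexed by the edge e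
  -- (b(m_e) = u_e, e(m_e) = e, d(m_e) = δ u_e).
  inML : (L' : Fin m → Bool) → ℕ → Bool
  inML L' e = Maybe.is-just (iL L' e)

  inPm : (L' : Fin m → Bool) → ℕ → ℕ → Bool
  inPm L' e' e with iL L' e' | iR L' e'
  ... | just l | just r = inP l e ∨ inP r e
  ... | _      | _      = false

  mDemandOn : ℚ → (L' : Fin m → Bool) → ℕ → ℚ
  mDemandOn δ L' e =
    sumRange 1 (n ∸ 1) (λ e' → if inML L' e' ∧ inPm L' e' e then δ * ℕ→ℚ (u e') else 0ℚ)

  -- the maze pair (T(L'), M(L')) is K-thin:
  -- for every edge e and T'' ⊆ T(L') ∩ T_e with |T''| > K there is
  -- m ∈ M(L') ∩ M_e with min_{i∈T''} b(i) ≤ b(m) < max_{i∈T''} b(i)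
  -- (written as: some i ∈ T'' has b(i) ≤ b(m), some j ∈ T'' has b(m) < b(j)).
  MazeThin : ℚ → (Tstar L' : Fin m → Bool) → Set
  MazeThin K Tstar L' = ∀ e → IsEdge e → ∀ (T'' : Fin m → Bool) →
    (∀ i → T'' i ≡ true → TL Tstar L' i ≡ true × inP i e ≡ true) →
    K ℚ.< ℕ→ℚ (card T'') →
    ∃ λ e' → IsEdge e' × inML L' e' ≡ true × inPm L' e' e ≡ true ×
      (∃ λ i → T'' i ≡ true × b i ℕ.≤ u e') ×
      (∃ λ j → T'' j ≡ true × u e' ℕ.< b j)

module Submission where

-- Each m-task m_{e'} ∈ M(L') that uses the edge e is paid for by a task
-- c ∈ L'_{e'} with e ∈ P(c): as c is δ-large, d(m_{e'}) = δ u_{e'} = δ b(c) ≤ d(c), and a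
-- task has a single bottleneck edge, so d(M(L') ∩ M_e) ≤ d(L' ∩ T_e).  Since T(L') and
-- L' partition T*, the load on e is at most d(T* ∩ T_e) ≤ u_e.
--
-- Let T'' ⊆ T(L') ∩ T_e have more than k + 1/δ tasks, with bottleneck
-- capacities ranging over [lo, hi].  The tasks of T'' with b(i) = hi share one bottleneck
-- edge (capacities are distinct) and are δ-large tasks of the feasible T*, so there are at
-- most 1/δ of them.  The more than k others all cross the vertical probe
-- {e + ½} × (lo - ½, hi); by k-thinness some segment ℓ(j) ∈ L' crosses it as well, and the
-- m-task of j's bottleneck edge contains P(j) ∋ e and has capacity b(j) ∈ [lo, hi).

open import Defs
open import Algebra.Bundles using (CommutativeMonoid)
import Algebra.Properties.CommutativeSemigroup as CommSemigroupProperties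
open import Data.Bool using (Bool; true; false; T; _∧_; _∨_; not; if_then_else_)
open import Data.Bool.Properties using (T-≡)
open import Data.Empty using (⊥-elim)
open import Data.Fin using (Fin; zero; suc)
open import Data.Integer as ℤ using (+_)
import Data.Integer.Properties as ℤP
open import Data.Maybe using (Maybe; just; nothing; is-just)
open import Data.Nat as ℕ using (ℕ; zero; suc; z≤n; s≤s; _<ᵇ_; _≤ᵇ_; _≡ᵇ_)
import Data.Nat.Properties as ℕP
open import Data.Product using (_×_; _,_; ∃; proj₁; proj₂)
open import Data.Sum using (_⊎_; inj₁; inj₂)
open import Data.Rational as ℚ using (ℚ; 0ℚ; 1ℚ; _+_; _*_; _≤_; _<_; _/_; -_; Positive)
import Data.Rational.Properties as QP
import Data.Rational.Unnormalised as U
import Data.Rational.Unnormalised.Properties as UP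
open import Function.Bundles using (Equivalence)
open import Relation.Nullary using (Dec)
open import Relation.Nullary.Decidable using (⌊_⌋; fromWitness; toWitness)
open import Relation.Binary.PropositionalEquality
  using (_≡_; _≢_; refl; sym; trans; cong; cong₂; subst; subst₂)

ℕ→ℚ≃n/1 : ∀ n → ℚ.toℚᵘ (ℕ→ℚ n) U.≃ U.mkℚᵘ (+ n) 0
ℕ→ℚ≃n/1 n = QP.toℚᵘ-fromℚᵘ (U.mkℚᵘ (+ n) 0)

ℕ→ℚ-mono-≤ : ∀ {a c} → a ℕ.≤ c → ℕ→ℚ a ≤ ℕ→ℚ c
ℕ→ℚ-mono-≤ {a} {c} a≤c = QP.toℚᵘ-cancel-≤
  (UP.≤-respʳ-≃ (UP.≃-sym (ℕ→ℚ≃n/1 c)) (UP.≤-respˡ-≃ (UP.≃-sym (ℕ→ℚ≃n/1 a))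
    (U.*≤* (subst₂ ℤ._≤_ (sym (ℤP.*-identityʳ (+ a))) (sym (ℤP.*-identityʳ (+ c))) (ℤ.+≤+ a≤c)))))

ℕ→ℚ-mono-< : ∀ {a c} → a ℕ.< c → ℕ→ℚ a < ℕ→ℚ c
ℕ→ℚ-mono-< {a} {c} a<c = QP.toℚᵘ-cancel-<
  (UP.<-respʳ-≃ (UP.≃-sym (ℕ→ℚ≃n/1 c)) (UP.<-respˡ-≃ (UP.≃-sym (ℕ→ℚ≃n/1 a))
    (U.*<* (subst₂ ℤ._<_ (sym (ℤP.*-identityʳ (+ a))) (sym (ℤP.*-identityʳ (+ c))) (ℤ.+<+ a<c)))))

ℕ→ℚ-cancel-< : ∀ {a c} → ℕ→ℚ a < ℕ→ℚ c → a ℕ.< c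
ℕ→ℚ-cancel-< p = ℕP.≰⇒> λ c≤a → QP.<-irrefl refl (QP.<-≤-trans p (ℕ→ℚ-mono-≤ c≤a))

ℕ→ℚ-+ : ∀ a c → ℕ→ℚ (a ℕ.+ c) ≡ ℕ→ℚ a + ℕ→ℚ c
ℕ→ℚ-+ a c = QP.toℚᵘ-injective (UP.≃-trans (ℕ→ℚ≃n/1 (a ℕ.+ c)) (UP.≃-trans sum/1
   (UP.≃-sym (UP.≃-trans (QP.toℚᵘ-homo-+ (ℕ→ℚ a) (ℕ→ℚ c)) (UP.+-cong (ℕ→ℚ≃n/1 a) (ℕ→ℚ≃n/1 c))))))
  where
  sum/1 : U.mkℚᵘ (+ (a ℕ.+ c)) 0 U.≃ (U.mkℚᵘ (+ a) 0 U.+ U.mkℚᵘ (+ c) 0)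
  sum/1 = U.*≡* (cong (ℤ._* + 1) (sym (cong₂ ℤ._+_ (ℤP.*-identityʳ (+ a)) (ℤP.*-identityʳ (+ c)))))

0≤ℕ→ℚ : ∀ a → 0ℚ ≤ ℕ→ℚ a
0≤ℕ→ℚ a = ℕ→ℚ-mono-≤ {0} {a} z≤n

½ : ℚ
½ = + 1 / 2

0<½ : 0ℚ < ½
0<½ = ℚ.*<* (ℤ.+<+ (s≤s z≤n))

½<1 : ½ < 1ℚ
½<1 = ℚ.*<* (ℤ.+<+ (s≤s (s≤s z≤n)))

-- The point e + ½ separates the naturals ≤ e from those > e; this turns the rational
-- coordinates of the segment picture back into comparisons of naturals.
≤⇒<+½ : ∀ {a e} → a ℕ.≤ e → ℕ→ℚ a < ℕ→ℚ e + ½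
≤⇒<+½ {a} {e} a≤e = QP.≤-<-trans
  (subst (ℕ→ℚ a ≤_) (sym (QP.+-identityʳ (ℕ→ℚ e))) (ℕ→ℚ-mono-≤ a≤e))
  (QP.+-monoʳ-< (ℕ→ℚ e) 0<½)

<⇒+½< : ∀ {e a} → e ℕ.< a → ℕ→ℚ e + ½ < ℕ→ℚ a
<⇒+½< {e} {a} e<a = QP.<-≤-trans
  (QP.+-monoʳ-< (ℕ→ℚ e) ½<1)
  (subst (_≤ ℕ→ℚ a) (trans (ℕ→ℚ-+ 1 e) (QP.+-comm 1ℚ (ℕ→ℚ e))) (ℕ→ℚ-mono-≤ e<a))

<+½⇒≤ : ∀ {a e} → ℕ→ℚ a < ℕ→ℚ e + ½ → a ℕ.≤ e
<+½⇒≤ p = ℕP.≮⇒≥ λ e<a → QP.<-asym p (<⇒+½< e<a)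

+½<⇒< : ∀ {e a} → ℕ→ℚ e + ½ < ℕ→ℚ a → e ℕ.< a
+½<⇒< p = ℕP.≰⇒> λ a≤e → QP.<-asym p (≤⇒<+½ a≤e)

-- A rational just below the natural c: exactly the naturals ≥ c lie above it.
justBelow : ℕ → ℚ
justBelow zero    = - 1ℚ
justBelow (suc c) = ℕ→ℚ c + ½

≤⇒justBelow< : ∀ {c a} → c ℕ.≤ a → justBelow c < ℕ→ℚ a
≤⇒justBelow< {zero}  {a} _   = QP.<-≤-trans { - 1ℚ} {0ℚ} (ℚ.*<* ℤ.-<+) (0≤ℕ→ℚ a)
≤⇒justBelow< {suc c}     c<a = <⇒+½< c<a

justBelow<⇒≤ : ∀ {c a} → justBelow c < ℕ→ℚ a → c ℕ.≤ a
justBelow<⇒≤ {zero}  _ = z≤n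
justBelow<⇒≤ {suc c} p = +½<⇒< p

count≤inv : ∀ δ (δpos : Positive δ) c U → 0 ℕ.< U →
  ℕ→ℚ c * (δ * ℕ→ℚ U) ≤ ℕ→ℚ U → ℕ→ℚ c ≤ inv δ δpos
count≤inv δ δpos c U U>0 fits = begin
  ℕ→ℚ c           ≡⟨ sym cδ/δ≡c ⟩
  ℕ→ℚ c * δ * 1/δ ≤⟨ QP.*-monoʳ-≤-nonNeg 1/δ {{QP.pos⇒nonNeg 1/δ {{QP.1/pos⇒pos δ {{δpos}}}}}} cδ≤1 ⟩
  1ℚ * 1/δ        ≡⟨ QP.*-identityˡ 1/δ ⟩
  1/δ             ∎
  where
  open QP.≤-Reasoning
  1/δ : ℚ
  1/δ = inv δ δpos
  instance
    U-pos : Positive (ℕ→ℚ U)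
    U-pos = ℚ.positive (ℕ→ℚ-mono-< {0} {U} U>0)
  cδ≤1 : ℕ→ℚ c * δ ≤ 1ℚ
  cδ≤1 = QP.*-cancelʳ-≤-pos (ℕ→ℚ U)
    (subst₂ _≤_ (sym (QP.*-assoc (ℕ→ℚ c) δ (ℕ→ℚ U))) (sym (QP.*-identityˡ (ℕ→ℚ U))) fits)
  cδ/δ≡c : ℕ→ℚ c * δ * 1/δ ≡ ℕ→ℚ c
  cδ/δ≡c = trans (QP.*-assoc (ℕ→ℚ c) δ 1/δ)
    (trans (cong (ℕ→ℚ c *_) (QP.*-inverseʳ δ {{QP.pos⇒nonZero δ {{δpos}}}})) (QP.*-identityʳ (ℕ→ℚ c)))

≤+nonNeg : ∀ x y → 0ℚ ≤ y → x ≤ x + y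
≤+nonNeg x y y≥0 = subst (_≤ x + y) (QP.+-identityʳ x) (QP.+-monoʳ-≤ x y≥0)

≤nonNeg+ : ∀ y x → 0ℚ ≤ y → x ≤ y + x
≤nonNeg+ y x y≥0 = subst (x ≤_) (QP.+-comm x y) (≤+nonNeg x y y≥0)

sumFin-mono : ∀ {m} (f g : Fin m → ℚ) → (∀ i → f i ≤ g i) → sumFin f ≤ sumFin g
sumFin-mono {zero}  f g f≤g = QP.≤-refl
sumFin-mono {suc m} f g f≤g =
  QP.+-mono-≤ (f≤g zero) (sumFin-mono (λ i → f (suc i)) (λ i → g (suc i)) (λ i → f≤g (suc i)))

sumFin-nonNeg : ∀ {m} (f : Fin m → ℚ) → (∀ i → 0ℚ ≤ f i) → 0ℚ ≤ sumFin f
sumFin-nonNeg {zero}  f f≥0 = QP.≤-refl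
sumFin-nonNeg {suc m} f f≥0 =
  QP.+-mono-≤ {0ℚ} {f zero} {0ℚ} (f≥0 zero) (sumFin-nonNeg (λ i → f (suc i)) (λ i → f≥0 (suc i)))

term≤sumFin : ∀ {m} (f : Fin m → ℚ) → (∀ i → 0ℚ ≤ f i) → ∀ j → f j ≤ sumFin f
term≤sumFin {suc m} f f≥0 zero =
  ≤+nonNeg (f zero) _ (sumFin-nonNeg (λ i → f (suc i)) (λ i → f≥0 (suc i)))
term≤sumFin {suc m} f f≥0 (suc j) =
  QP.≤-trans (term≤sumFin (λ i → f (suc i)) (λ i → f≥0 (suc i)) j) (≤nonNeg+ (f zero) _ (f≥0 zero))

open CommSemigroupProperties (CommutativeMonoid.commutativeSemigroup QP.+-0-commutativeMonoid)
  using (interchange)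

sumFin-+ : ∀ {m} (f g : Fin m → ℚ) → sumFin (λ i → f i + g i) ≡ sumFin f + sumFin g
sumFin-+ {zero}  f g = refl
sumFin-+ {suc m} f g =
  trans (cong (λ s → (f zero + g zero) + s) (sumFin-+ (λ i → f (suc i)) (λ i → g (suc i))))
        (interchange (f zero) (g zero) _ _)

sumFin-zero : ∀ {m} → sumFin {m} (λ _ → 0ℚ) ≡ 0ℚ
sumFin-zero {zero}  = refl
sumFin-zero {suc m} = cong (λ s → 0ℚ + s) (sumFin-zero {m})

sumRange-mono : ∀ a len (f g : ℕ → ℚ) → (∀ x → f x ≤ g x) → sumRange a len f ≤ sumRange a len g
sumRange-mono a zero      f g f≤g = QP.≤-refl
sumRange-mono a (suc len) f g f≤g = QP.+-mono-≤ (f≤g a) (sumRange-mono (suc a) len f g f≤g)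

sumRange-sumFin : ∀ {m} a len (F : ℕ → Fin m → ℚ) →
  sumRange a len (λ x → sumFin (F x)) ≡ sumFin (λ i → sumRange a len (λ x → F x i))
sumRange-sumFin {m} a zero F = sym (sumFin-zero {m})
sumRange-sumFin a (suc len) F =
  trans (cong (λ s → sumFin (F a) + s) (sumRange-sumFin (suc a) len F))
        (sym (sumFin-+ (F a) (λ i → sumRange (suc a) len (λ x → F x i))))

sumRange-none : ∀ a len (P : ℕ → Bool) (c : ℚ) → (∀ x → a ℕ.≤ x → P x ≡ false) →
  sumRange a len (λ x → if P x then c else 0ℚ) ≡ 0ℚ
sumRange-none a zero      P c none = refl
sumRange-none a (suc len) P c none rewrite none a ℕP.≤-refl =
  trans (QP.+-identityˡ _) (sumRange-none (suc a) len P c (λ x a<x → none x (ℕP.<⇒≤ a<x)))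

sumRange-atMostOne : ∀ a len (P : ℕ → Bool) (c : ℚ) → 0ℚ ≤ c →
  (∀ x y → P x ≡ true → P y ≡ true → x ≡ y) →
  sumRange a len (λ x → if P x then c else 0ℚ) ≤ c
sumRange-atMostOne a zero      P c c≥0 unique = c≥0
sumRange-atMostOne a (suc len) P c c≥0 unique with P a in Pa
... | false = subst (_≤ c) (sym (QP.+-identityˡ _)) (sumRange-atMostOne (suc a) len P c c≥0 unique)
... | true  = QP.≤-reflexive
  (trans (cong (λ s → c + s) (sumRange-none (suc a) len P c onlyAtA)) (QP.+-identityʳ c))
  where
  onlyAtA : ∀ x → suc a ℕ.≤ x → P x ≡ false
  onlyAtA x a<x with P x in Px
  ... | false = refl
  ... | true  = ⊥-elim (ℕP.<⇒≢ a<x (sym (unique x a Px Pa)))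

card·≤sumFin : ∀ {m} (E : Fin m → Bool) (c : ℚ) (g : Fin m → ℚ) →
  (∀ i → E i ≡ true → c ≤ g i) → (∀ i → 0ℚ ≤ g i) → ℕ→ℚ (card E) * c ≤ sumFin g
card·≤sumFin {zero}  E c g big g≥0 = QP.≤-reflexive (QP.*-zeroˡ c)
card·≤sumFin {suc m} E c g big g≥0 with E zero in E0
... | false = QP.≤-trans rest (≤nonNeg+ (g zero) _ (g≥0 zero))
  where
  rest : ℕ→ℚ (card (λ i → E (suc i))) * c ≤ sumFin (λ i → g (suc i))
  rest = card·≤sumFin (λ i → E (suc i)) c (λ i → g (suc i)) (λ i → big (suc i)) (λ i → g≥0 (suc i))
... | true  = subst (_≤ sumFin g) (sym (1+r·c≡c+r·c)) (QP.+-mono-≤ (big zero E0) rest)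
  where
  r : ℕ
  r = card (λ i → E (suc i))
  rest : ℕ→ℚ r * c ≤ sumFin (λ i → g (suc i))
  rest = card·≤sumFin (λ i → E (suc i)) c (λ i → g (suc i)) (λ i → big (suc i)) (λ i → g≥0 (suc i))
  1+r·c≡c+r·c : ℕ→ℚ (suc r) * c ≡ c + ℕ→ℚ r * c
  1+r·c≡c+r·c = trans (cong (_* c) (ℕ→ℚ-+ 1 r))
    (trans (QP.*-distribʳ-+ c 1ℚ (ℕ→ℚ r)) (cong (_+ ℕ→ℚ r * c) (QP.*-identityˡ c)))

card-split : ∀ {m} (S P : Fin m → Bool) →
  card S ≡ card (λ i → S i ∧ P i) ℕ.+ card (λ i → S i ∧ not (P i))
card-split {zero}  S P = refl
card-split {suc m} S P with S zero | P zero
... | false | _     = card-split (λ i → S (suc i)) (λ i → P (suc i))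
... | true  | true  = cong suc (card-split (λ i → S (suc i)) (λ i → P (suc i)))
... | true  | false = trans (cong suc (card-split (λ i → S (suc i)) (λ i → P (suc i))))
                           (sym (ℕP.+-suc _ _))

card-mono : ∀ {m} (A B : Fin m → Bool) → (∀ i → A i ≡ true → B i ≡ true) → card A ℕ.≤ card B
card-mono {zero}  A B A⊆B = z≤n
card-mono {suc m} A B A⊆B with A zero in A0 | B zero in B0
... | true  | true  = s≤s (card-mono _ _ (λ i → A⊆B (suc i)))
... | true  | false with () ← trans (sym (A⊆B zero A0)) B0
... | false | true  = ℕP.m≤n⇒m≤1+n (card-mono _ _ (λ i → A⊆B (suc i)))
... | false | false = card-mono _ _ (λ i → A⊆B (suc i))

card-empty : ∀ {m} (S : Fin m → Bool) → (∀ i → S i ≡ false) → card S ≡ 0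
card-empty {zero}  S empty = refl
card-empty {suc m} S empty rewrite empty zero = card-empty _ (λ i → empty (suc i))

if-true : ∀ {c} {x y : ℚ} → c ≡ true → (if c then x else y) ≡ x
if-true refl = refl

if-nonNeg : ∀ c {x} → 0ℚ ≤ x → 0ℚ ≤ (if c then x else 0ℚ)
if-nonNeg true  x≥0 = x≥0
if-nonNeg false _   = QP.≤-refl

T⇒true : ∀ {x} → T x → x ≡ true
T⇒true = Equivalence.to T-≡

true⇒T : ∀ {x} → x ≡ true → T x
true⇒T = Equivalence.from T-≡

∧-elimˡ : ∀ {x y} → x ∧ y ≡ true → x ≡ true
∧-elimˡ {true} _ = refl

∧-elimʳ : ∀ {x y} → x ∧ y ≡ true → y ≡ true
∧-elimʳ {true} y≡true = y≡true

∧-intro : ∀ {x y} → x ≡ true → y ≡ true → x ∧ y ≡ true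
∧-intro refl refl = refl

∨-introʳ-unless : ∀ x {y} → (x ≡ false → y ≡ true) → x ∨ y ≡ true
∨-introʳ-unless true  _ = refl
∨-introʳ-unless false y = y refl

false≢true : false ≢ true
false≢true ()

not-true⇒false : ∀ {x} → not x ≡ true → x ≢ true
not-true⇒false {true} () _

<ᵇ⇒< : ∀ {a c} → (a <ᵇ c) ≡ true → a ℕ.< c
<ᵇ⇒< {a} {c} p = ℕP.<ᵇ⇒< a c (true⇒T p)

<⇒<ᵇ : ∀ {a c} → a ℕ.< c → (a <ᵇ c) ≡ true
<⇒<ᵇ p = T⇒true (ℕP.<⇒<ᵇ p)

≤ᵇ⇒≤ : ∀ {a c} → (a ≤ᵇ c) ≡ true → a ℕ.≤ c
≤ᵇ⇒≤ {a} {c} p = ℕP.≤ᵇ⇒≤ a c (true⇒T p)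

≤⇒≤ᵇ : ∀ {a c} → a ℕ.≤ c → (a ≤ᵇ c) ≡ true
≤⇒≤ᵇ p = T⇒true (ℕP.≤⇒≤ᵇ p)

≡ᵇ⇒≡ : ∀ {a c} → (a ≡ᵇ c) ≡ true → a ≡ c
≡ᵇ⇒≡ {a} {c} p = ℕP.≡ᵇ⇒≡ a c (true⇒T p)

≡⇒≡ᵇ : ∀ {a c} → a ≡ c → (a ≡ᵇ c) ≡ true
≡⇒≡ᵇ {a} {c} p = T⇒true (ℕP.≡⇒≡ᵇ a c p)

<ᵇ-false⇒≥ : ∀ {a c} → (a <ᵇ c) ≡ false → c ℕ.≤ a
<ᵇ-false⇒≥ p = ℕP.≮⇒≥ λ a<c → false≢true (trans (sym p) (<⇒<ᵇ a<c))

≥⇒<ᵇ-false : ∀ {a c} → c ℕ.≤ a → (a <ᵇ c) ≡ false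
≥⇒<ᵇ-false {a} {c} c≤a with a <ᵇ c in p
... | false = refl
... | true  = ⊥-elim (ℕP.<⇒≱ (<ᵇ⇒< p) c≤a)

data Best {m} (S : Fin m → Bool) (Opt : Fin m → Fin m → Set) : Maybe (Fin m) → Set where
  none : (∀ z → S z ≡ false) → Best S Opt nothing
  some : ∀ {x} → S x ≡ true → (∀ z → S z ≡ true → Opt x z) → Best S Opt (just x)

Best-map : ∀ {m S} {Opt Opt′ : Fin m → Fin m → Set} {mx} →
  (∀ {x z} → Opt x z → Opt′ x z) → Best S Opt mx → Best S Opt′ mx
Best-map f (none empty)  = none empty
Best-map f (some Sx opt) = some Sx (λ z Sz → f (opt z Sz))

asym⇒irrefl : ∀ {m} (better : Fin m → Fin m → Bool) →
  (∀ i j → better i j ≡ true → better j i ≡ false) → ∀ i → better i i ≡ false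
asym⇒irrefl better asym i with better i i in bii
... | false = refl
... | true  = trans (sym bii) (asym i i bii)

argBest-best : ∀ {m} (S : Fin m → Bool) (better : Fin m → Fin m → Bool) →
  (∀ i j → better i j ≡ true → better j i ≡ false) →
  (∀ i j k → better i j ≡ false → better j k ≡ false → better i k ≡ false) →
  Best S (λ x z → better z x ≡ false) (argBest S better)
argBest-best {zero} S better asym ntrans = none (λ ())
argBest-best {suc m} S better asym ntrans
  with S zero in S0 | argBest (λ i → S (suc i)) (λ i j → better (suc i) (suc j))
     | argBest-best (λ i → S (suc i)) (λ i j → better (suc i) (suc j))
         (λ i j → asym (suc i) (suc j)) (λ i j k → ntrans (suc i) (suc j) (suc k))
... | false | nothing | none empty = none λ { zero → S0 ; (suc z) → empty z }
... | false | just x  | some Sx opt = some Sx λ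
  { zero S0′ → ⊥-elim (false≢true (trans (sym S0) S0′)) ; (suc z) Sz → opt z Sz }
... | true  | nothing | none empty = some S0 λ
  { zero _ → asym⇒irrefl better asym zero ; (suc z) Sz → ⊥-elim (false≢true (trans (sym (empty z)) Sz)) }
... | true  | just x  | some Sx opt with better (suc x) zero in x-beats-0
...   | true  = some Sx λ { zero _ → asym (suc x) zero x-beats-0 ; (suc z) Sz → opt z Sz }
...   | false = some S0 λ
  { zero _ → asym⇒irrefl better asym zero ; (suc z) Sz → ntrans (suc z) (suc x) zero (opt z Sz) x-beats-0 }

<ᵇ-asym : ∀ a c → (a <ᵇ c) ≡ true → (c <ᵇ a) ≡ false
<ᵇ-asym a c a<c = ≥⇒<ᵇ-false {c} {a} (ℕP.<⇒≤ (<ᵇ⇒< a<c))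

≮ᵇ-trans : ∀ a c e → (a <ᵇ c) ≡ false → (c <ᵇ e) ≡ false → (a <ᵇ e) ≡ false
≮ᵇ-trans a c e a≮c c≮e =
  ≥⇒<ᵇ-false {a} {e} (ℕP.≤-trans (<ᵇ-false⇒≥ {c} {e} c≮e) (<ᵇ-false⇒≥ {a} {c} a≮c))

argMin : ∀ {m} (S : Fin m → Bool) (f : Fin m → ℕ) →
  Best S (λ x z → f x ℕ.≤ f z) (argBest S (λ i j → f i <ᵇ f j))
argMin S f = Best-map <ᵇ-false⇒≥
  (argBest-best S _ (λ i j → <ᵇ-asym (f i) (f j)) (λ i j k → ≮ᵇ-trans (f i) (f j) (f k)))

argMax : ∀ {m} (S : Fin m → Bool) (f : Fin m → ℕ) →
  Best S (λ x z → f z ℕ.≤ f x) (argBest S (λ i j → f j <ᵇ f i))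
argMax S f = Best-map <ᵇ-false⇒≥
  (argBest-best S _ (λ i j → <ᵇ-asym (f j) (f i)) (λ i j k p q → ≮ᵇ-trans (f k) (f j) (f i) q p))

minCap-attained : ∀ (u : ℕ → ℕ) a len → 0 ℕ.< len →
  ∃ λ e → a ℕ.≤ e × e ℕ.< a ℕ.+ len × minCap u a len ≡ u e
minCap-attained u a (suc zero) _ = a , ℕP.≤-refl , ℕP.m<m+n a (s≤s z≤n) , refl
minCap-attained u a (suc (suc len)) _
  with ℕP.⊓-sel (u a) (minCap u (suc a) (suc len)) | minCap-attained u (suc a) (suc len) (s≤s z≤n)
... | inj₁ at-a | _ = a , ℕP.≤-refl , ℕP.m<m+n a (s≤s z≤n) , at-a
... | inj₂ in-rest | e , a<e , e<end , min≡ue =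
  e , ℕP.<⇒≤ a<e , subst (e ℕ.<_) (sym (ℕP.+-suc a (suc len))) e<end , trans in-rest min≡ue

module _ (I : UFP) (st : Standing I) where
  open UFP I
  open Standing st

  inP-intro : ∀ i e → s i ℕ.≤ e → e ℕ.< t i → inP I i e ≡ true
  inP-intro i e s≤e e<t = ∧-intro (≤⇒≤ᵇ s≤e) (<⇒<ᵇ e<t)

  inP-start : ∀ i e → inP I i e ≡ true → s i ℕ.≤ e
  inP-start i e e∈P = ≤ᵇ⇒≤ (∧-elimˡ e∈P)

  inP-end : ∀ i e → inP I i e ≡ true → e ℕ.< t i
  inP-end i e e∈P = <ᵇ⇒< (∧-elimʳ {s i ≤ᵇ e} e∈P)

  inP-edge : ∀ i e → inP I i e ≡ true → IsEdge I e
  inP-edge i e e∈P = ℕP.≤-trans (s-pos i) (inP-start i e e∈P) , ℕP.<-≤-trans (inP-end i e e∈P) (t≤n i)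

  bottleneck : ∀ i → ∃ λ e → inP I i e ≡ true × u e ≡ b I i
  bottleneck i with minCap-attained u (s i) (t i ℕ.∸ s i) (ℕP.m<n⇒0<n∸m (s<t i))
  ... | e , s≤e , e<end , b≡ue =
    e , inP-intro i e s≤e (subst (e ℕ.<_) (ℕP.m+[n∸m]≡n (ℕP.<⇒≤ (s<t i))) e<end) , sym b≡ue

  -- Capacities are distinct, so an edge of capacity b(i) is the bottleneck edge of i.
  capacity⇒bottleneck : ∀ i e → IsEdge I e → u e ≡ b I i → isBottleneck I i e ≡ true
  capacity⇒bottleneck i e e-edge ue≡b with bottleneck i
  ... | e′ , e′∈P , ue′≡b with cap-distinct e′ e (inP-edge i e′ e′∈P) e-edge (trans ue′≡b (sym ue≡b))
  ...   | refl = ∧-intro e′∈P (≡⇒≡ᵇ ue′≡b)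

  bottleneck-capacity : ∀ i e → isBottleneck I i e ≡ true → u e ≡ b I i
  bottleneck-capacity i e bn = ≡ᵇ⇒≡ (∧-elimʳ {inP I i e} bn)

  bottleneck-unique : ∀ i x y → isBottleneck I i x ≡ true → isBottleneck I i y ≡ true → x ≡ y
  bottleneck-unique i x y bx by = cap-distinct x y (inP-edge i x (∧-elimˡ bx)) (inP-edge i y (∧-elimˡ by))
    (trans (bottleneck-capacity i x bx) (sym (bottleneck-capacity i y by)))

  d≥0 : ∀ i → 0ℚ ≤ d i
  d≥0 i = QP.<⇒≤ (d-pos i)

  inPm-just : ∀ L' e′ e {l r} → iL I L' e′ ≡ just l → iR I L' e′ ≡ just r →
    inPm I L' e′ e ≡ (inP I l e ∨ inP I r e)
  inPm-just L' e′ e iL≡l iR≡r rewrite iL≡l | iR≡r = refl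

  iL-best : ∀ L' e′ → Best (Le I L' e′) (λ x z → s x ℕ.≤ s z) (iL I L' e′)
  iL-best L' e′ = argMin (Le I L' e′) s

  iR-best : ∀ L' e′ → Best (Le I L' e′) (λ x z → t z ℕ.≤ t x) (iR I L' e′)
  iR-best L' e′ = argMax (Le I L' e′) t

  record Ends (L' : Fin m → Bool) (e′ : ℕ) : Set where
    field
      l r     : Fin m
      iL≡l    : iL I L' e′ ≡ just l
      iR≡r    : iR I L' e′ ≡ just r
      l∈      : Le I L' e′ l ≡ true
      r∈      : Le I L' e′ r ≡ true
      l-first : ∀ z → Le I L' e′ z ≡ true → s l ℕ.≤ s z
      r-last  : ∀ z → Le I L' e′ z ≡ true → t z ℕ.≤ t r

  ends : ∀ L' e′ → (iL I L' e′ ≡ nothing × (∀ z → Le I L' e′ z ≡ false)) ⊎ Ends L' e′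
  ends L' e′ = from (iL-best L' e′) (iR-best L' e′) refl refl
    where
    from : ∀ {ml mr} → Best (Le I L' e′) (λ x z → s x ℕ.≤ s z) ml →
      Best (Le I L' e′) (λ x z → t z ℕ.≤ t x) mr → iL I L' e′ ≡ ml → iR I L' e′ ≡ mr →
      (iL I L' e′ ≡ nothing × (∀ z → Le I L' e′ z ≡ false)) ⊎ Ends L' e′
    from (none empty) _ iL≡nothing _ = inj₁ (iL≡nothing , empty)
    from (some {l} l∈ _) (none empty) _ _ = ⊥-elim (false≢true (trans (sym (empty l)) l∈))
    from (some {l} l∈ l-first) (some {r} r∈ r-last) iL≡l iR≡r =
      inj₂ (record { iL≡l = iL≡l ; iR≡r = iR≡r ; l∈ = l∈ ; r∈ = r∈ ; l-first = l-first ; r-last = r-last })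

  -- Every j ∈ L'_{e'} has P(j) ⊆ P(i_L) ∪ P(i_R), since s(i_L) ≤ s(j), t(j) ≤ t(i_R) and
  -- both P(i_L) and P(i_R) contain e'.  So m_{e'} ∈ M(L') uses every edge of P(j).
  mTask-covers : ∀ L' e′ j e → Le I L' e′ j ≡ true → inP I j e ≡ true →
    inML I L' e′ ≡ true × inPm I L' e′ e ≡ true
  mTask-covers L' e′ j e j∈L'e′ e∈Pj with ends L' e′
  ... | inj₁ (_ , empty) = ⊥-elim (false≢true (trans (sym (empty j)) j∈L'e′))
  ... | inj₂ lr = cong is-just iL≡l , trans (inPm-just L' e′ e iL≡l iR≡r) (∨-introʳ-unless (inP I l e) e∈Pr)
    where
    open Ends lr
    e′∈Pl : inP I l e′ ≡ true
    e′∈Pl = ∧-elimˡ (∧-elimʳ {L' l} l∈)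
    e′∈Pr : inP I r e′ ≡ true
    e′∈Pr = ∧-elimˡ (∧-elimʳ {L' r} r∈)
    -- If e ∉ P(i_L), then P(i_L), which starts no later than e, ends at or before e;
    -- so e' < e, and P(i_R) ∋ e' reaches beyond e since t(i_R) ≥ t(j) > e.
    e∈Pr : inP I l e ≡ false → inP I r e ≡ true
    e∈Pr e∉Pl = inP-intro r e (ℕP.≤-trans (inP-start r e′ e′∈Pr) (ℕP.<⇒≤ e′<e))
                              (ℕP.<-≤-trans (inP-end j e e∈Pj) (r-last j j∈L'e′))
      where
      tl≤e : t l ℕ.≤ e
      tl≤e = ℕP.≮⇒≥ λ e<tl → false≢true (trans (sym e∉Pl)
        (inP-intro l e (ℕP.≤-trans (l-first j j∈L'e′) (inP-start j e e∈Pj)) e<tl))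
      e′<e : e′ ℕ.< e
      e′<e = ℕP.<-≤-trans (inP-end l e′ e′∈Pl) tl≤e

  mTask-payer : ∀ L' e′ e → inML I L' e′ ∧ inPm I L' e′ e ≡ true →
    ∃ λ c → Le I L' e′ c ≡ true × inP I c e ≡ true
  mTask-payer L' e′ e m∈ with ends L' e′
  ... | inj₁ (iL≡nothing , _) =
    ⊥-elim (false≢true (trans (sym (cong is-just iL≡nothing)) (∧-elimˡ m∈)))
  ... | inj₂ lr = payer (inP I (Ends.l lr) e) refl
    where
    open Ends lr
    e∈Pm : inP I l e ∨ inP I r e ≡ true
    e∈Pm = trans (sym (inPm-just L' e′ e iL≡l iR≡r)) (∧-elimʳ {inML I L' e′} m∈)
    payer : ∀ c → inP I l e ≡ c → ∃ λ c → Le I L' e′ c ≡ true × inP I c e ≡ true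
    payer true  e∈Pl = l , l∈ , e∈Pl
    payer false e∉Pl = r , r∈ , subst (λ c → c ∨ inP I r e ≡ true) e∉Pl e∈Pm

  charge : (L' : Fin m → Bool) → ℕ → ℕ → Fin m → ℚ
  charge L' e e′ i = if L' i ∧ inP I i e then (if isBottleneck I i e′ then d i else 0ℚ) else 0ℚ

  charge≥0 : ∀ L' e e′ i → 0ℚ ≤ charge L' e e′ i
  charge≥0 L' e e′ i = if-nonNeg (L' i ∧ inP I i e) (if-nonNeg (isBottleneck I i e′) (d≥0 i))

  charge-of-payer : ∀ L' e e′ c → Le I L' e′ c ≡ true → inP I c e ≡ true → charge L' e e′ c ≡ d c
  charge-of-payer L' e e′ c c∈ e∈Pc =
    trans (if-true {L' c ∧ inP I c e} (∧-intro (∧-elimˡ {L' c} c∈) e∈Pc)) (if-true (∧-elimʳ {L' c} c∈))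

  mTask≤charges : ∀ δ → DeltaLarge I δ → ∀ L' e e′ →
    (if inML I L' e′ ∧ inPm I L' e′ e then δ * ℕ→ℚ (u e′) else 0ℚ) ≤ sumFin (charge L' e e′)
  mTask≤charges δ large L' e e′ with inML I L' e′ ∧ inPm I L' e′ e in m∈
  ... | false = sumFin-nonNeg (charge L' e e′) (charge≥0 L' e e′)
  ... | true with mTask-payer L' e′ e m∈
  ...   | c , c∈ , e∈Pc = QP.≤-trans δu≤dc (term≤sumFin (charge L' e e′) (charge≥0 L' e e′) c)
    where
    δu≤dc : δ * ℕ→ℚ (u e′) ≤ charge L' e e′ c
    δu≤dc = subst₂ _≤_
      (cong (λ x → δ * ℕ→ℚ x) (sym (bottleneck-capacity c e′ (∧-elimʳ {L' c} c∈))))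
      (sym (charge-of-payer L' e e′ c c∈ e∈Pc))
      (large c)

  -- A task is charged to its single bottleneck edge only.
  charges≤demand : ∀ L' e i →
    sumRange 1 (n ℕ.∸ 1) (λ e′ → charge L' e e′ i) ≤ (if L' i ∧ inP I i e then d i else 0ℚ)
  charges≤demand L' e i with L' i ∧ inP I i e
  ... | true  = sumRange-atMostOne 1 (n ℕ.∸ 1) (isBottleneck I i) (d i) (d≥0 i) (bottleneck-unique i)
  ... | false = QP.≤-reflexive (sumRange-none 1 (n ℕ.∸ 1) (λ _ → false) 0ℚ (λ _ _ → refl))

  mDemand≤demand : ∀ δ → DeltaLarge I δ → ∀ L' e → mDemandOn I δ L' e ≤ demandOn I L' e
  mDemand≤demand δ large L' e = begin
    mDemandOn I δ L' e
      ≤⟨ sumRange-mono 1 (n ℕ.∸ 1) _ _ (mTask≤charges δ large L' e) ⟩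
    sumRange 1 (n ℕ.∸ 1) (λ e′ → sumFin (charge L' e e′))
      ≡⟨ sumRange-sumFin 1 (n ℕ.∸ 1) (charge L' e) ⟩
    sumFin (λ i → sumRange 1 (n ℕ.∸ 1) (λ e′ → charge L' e e′ i))
      ≤⟨ sumFin-mono _ _ (charges≤demand L' e) ⟩
    demandOn I L' e ∎
    where open QP.≤-Reasoning

  demand-partition : ∀ S L' → (∀ i → L' i ≡ true → S i ≡ true) → ∀ e →
    demandOn I (TL I S L') e + demandOn I L' e ≤ demandOn I S e
  demand-partition S L' L'⊆S e =
    subst (_≤ demandOn I S e) (sumFin-+ (load (TL I S L')) (load L')) (sumFin-mono _ _ pointwise)
    where
    load : (Fin m → Bool) → Fin m → ℚ
    load A i = if A i ∧ inP I i e then d i else 0ℚ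
    pointwise : ∀ i → load (TL I S L') i + load L' i ≤ load S i
    pointwise i with L' i in L'i | S i in Si | inP I i e
    ... | true  | false | _     with () ← trans (sym (L'⊆S i L'i)) Si
    ... | true  | true  | true  = QP.≤-reflexive (QP.+-identityˡ (d i))
    ... | false | true  | true  = QP.≤-reflexive (QP.+-identityʳ (d i))
    ... | true  | true  | false = QP.≤-refl
    ... | false | true  | false = QP.≤-refl
    ... | false | false | _     = QP.≤-refl

  maze-feasible : ∀ δ → DeltaLarge I δ → ∀ Tstar L' → Feasible I Tstar →
    (∀ i → L' i ≡ true → Tstar i ≡ true) →
    ∀ e → IsEdge I e → demandOn I (TL I Tstar L') e + mDemandOn I δ L' e ≤ ℕ→ℚ (u e)
  maze-feasible δ large Tstar L' feasT L'⊆T* e e-edge =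
    QP.≤-trans (QP.+-monoʳ-≤ (demandOn I (TL I Tstar L') e) (mDemand≤demand δ large L' e))
      (QP.≤-trans (demand-partition Tstar L' L'⊆T* e) (feasT e e-edge))

  -- At most 1/δ tasks of a feasible set S of δ-large tasks have bottleneck capacity u_{e*}:
  -- all of them use e* (capacities are distinct) and each has demand at least δ u_{e*}.
  sameBottleneck≤inv : ∀ δ (δpos : Positive δ) → DeltaLarge I δ → ∀ S → Feasible I S →
    ∀ (E : Fin m → Bool) e* → IsEdge I e* → (∀ i → E i ≡ true → S i ≡ true × b I i ≡ u e*) →
    ℕ→ℚ (card E) ≤ inv δ δpos
  sameBottleneck≤inv δ δpos large S feasS E e* e*-edge E-top =
    count≤inv δ δpos (card E) (u e*) (cap-pos e* e*-edge)
      (QP.≤-trans (card·≤sumFin E (δ * ℕ→ℚ (u e*)) load member-load load≥0) (feasS e* e*-edge))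
    where
    load : Fin m → ℚ
    load i = if S i ∧ inP I i e* then d i else 0ℚ
    load≥0 : ∀ i → 0ℚ ≤ load i
    load≥0 i = if-nonNeg (S i ∧ inP I i e*) (d≥0 i)
    member-load : ∀ i → E i ≡ true → δ * ℕ→ℚ (u e*) ≤ load i
    member-load i i∈E =
      subst₂ _≤_ (cong (λ c → δ * ℕ→ℚ c) bi≡u) (sym (if-true {S i ∧ inP I i e*} (∧-intro Si e*∈Pi))) (large i)
      where
      Si : S i ≡ true
      Si = proj₁ (E-top i i∈E)
      bi≡u : b I i ≡ u e*
      bi≡u = proj₂ (E-top i i∈E)
      e*∈Pi : inP I i e* ≡ true
      e*∈Pi = ∧-elimˡ (capacity⇒bottleneck i e* e*-edge (sym bi≡u))

  intersects-intro : ∀ x yb yt i → ℕ→ℚ (s i) < x → x < ℕ→ℚ (t i) → yb < ℕ→ℚ (b I i) →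
    ℕ→ℚ (b I i) < yt → intersects I x yb yt i ≡ true
  intersects-intro x yb yt i s<x x<t yb<b b<yt =
    ∧-intro (T⇒true (fromWitness {a? = ℕ→ℚ (s i) QP.<? x} s<x))
   (∧-intro (T⇒true (fromWitness {a? = x QP.<? ℕ→ℚ (t i)} x<t))
   (∧-intro (T⇒true (fromWitness {a? = yb QP.<? ℕ→ℚ (b I i)} yb<b))
            (T⇒true (fromWitness {a? = ℕ→ℚ (b I i) QP.<? yt} b<yt))))

  intersects-elim : ∀ x yb yt i → intersects I x yb yt i ≡ true →
    ℕ→ℚ (s i) < x × x < ℕ→ℚ (t i) × yb < ℕ→ℚ (b I i) × ℕ→ℚ (b I i) < yt
  intersects-elim x yb yt i hit =
    toWitness (true⇒T s<x) , toWitness (true⇒T x<t) , toWitness (true⇒T yb<b) , toWitness (true⇒T b<yt)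
    where
    s<x? : Dec (ℕ→ℚ (s i) < x)
    s<x? = ℕ→ℚ (s i) QP.<? x
    x<t? : Dec (x < ℕ→ℚ (t i))
    x<t? = x QP.<? ℕ→ℚ (t i)
    yb<b? : Dec (yb < ℕ→ℚ (b I i))
    yb<b? = yb QP.<? ℕ→ℚ (b I i)
    b<yt? : Dec (ℕ→ℚ (b I i) < yt)
    b<yt? = ℕ→ℚ (b I i) QP.<? yt
    s<x : ⌊ s<x? ⌋ ≡ true
    s<x = ∧-elimˡ {⌊ s<x? ⌋} hit
    x<t : ⌊ x<t? ⌋ ≡ true
    x<t = ∧-elimˡ {⌊ x<t? ⌋} (∧-elimʳ {⌊ s<x? ⌋} hit)
    yb<b : ⌊ yb<b? ⌋ ≡ true
    yb<b = ∧-elimˡ {⌊ yb<b? ⌋} (∧-elimʳ {⌊ x<t? ⌋} (∧-elimʳ {⌊ s<x? ⌋} hit))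
    b<yt : ⌊ b<yt? ⌋ ≡ true
    b<yt = ∧-elimʳ {⌊ yb<b? ⌋} (∧-elimʳ {⌊ x<t? ⌋} (∧-elimʳ {⌊ s<x? ⌋} hit))

  probe : ℕ → ℕ → ℕ → Fin m → Bool
  probe e lo hi = intersects I (ℕ→ℚ e + ½) (justBelow lo) (ℕ→ℚ hi)

  probe-intro : ∀ e lo hi i → inP I i e ≡ true → lo ℕ.≤ b I i → b I i ℕ.< hi →
    probe e lo hi i ≡ true
  probe-intro e lo hi i e∈P lo≤b b<hi = intersects-intro (ℕ→ℚ e + ½) (justBelow lo) (ℕ→ℚ hi) i
    (≤⇒<+½ (inP-start i e e∈P)) (<⇒+½< (inP-end i e e∈P)) (≤⇒justBelow< lo≤b) (ℕ→ℚ-mono-< b<hi)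

  probe-elim : ∀ e lo hi i → probe e lo hi i ≡ true →
    inP I i e ≡ true × lo ℕ.≤ b I i × b I i ℕ.< hi
  probe-elim e lo hi i hit =
    let s<x , x<t , lo<b , b<hi = intersects-elim (ℕ→ℚ e + ½) (justBelow lo) (ℕ→ℚ hi) i hit
    in inP-intro i e (<+½⇒≤ s<x) (+½<⇒< x<t) , justBelow<⇒≤ lo<b , ℕ→ℚ-cancel-< b<hi

  module Thinness (δ : ℚ) (δpos : Positive δ) (large : DeltaLarge I δ)
                  (Tstar : Fin m → Bool) (feasT : Feasible I Tstar)
                  (k : ℕ) (L' : Fin m → Bool) (L'-thin : SegThin I k Tstar L') where

    1/δ : ℚ
    1/δ = inv δ δpos

    -- k + 1/δ ≥ 0, so a set with more than k + 1/δ members is nonempty.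
    0≤k+1/δ : 0ℚ ≤ ℕ→ℚ k + 1/δ
    0≤k+1/δ = QP.+-mono-≤ (0≤ℕ→ℚ k) (QP.<⇒≤ (QP.positive⁻¹ 1/δ {{QP.1/pos⇒pos δ {{δpos}}}}))

    MazeWitness : ℕ → (Fin m → Bool) → Set
    MazeWitness e T'' = ∃ λ e′ → IsEdge I e′ × inML I L' e′ ≡ true × inPm I L' e′ e ≡ true ×
      (∃ λ i → T'' i ≡ true × b I i ℕ.≤ u e′) × (∃ λ j → T'' j ≡ true × u e′ ℕ.< b I j)

    -- A task j ∈ L' through e with b(x) ≤ b(j) < b(y) for some x, y ∈ T'' yields the
    -- witness m_{e(j)}, which contains P(j) ∋ e and has capacity b(j).
    witness-from-L' : ∀ e T'' j x y → L' j ≡ true → inP I j e ≡ true →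
      T'' x ≡ true → b I x ℕ.≤ b I j → T'' y ≡ true → b I j ℕ.< b I y → MazeWitness e T''
    witness-from-L' e T'' j x y j∈L' e∈Pj x∈ bx≤bj y∈ bj<by =
      let e′ , e′∈Pj , ue′≡bj = bottleneck j
          m∈ , e∈Pm = mTask-covers L' e′ j e (∧-intro j∈L' (∧-intro e′∈Pj (≡⇒≡ᵇ ue′≡bj))) e∈Pj
      in e′ , inP-edge j e′ e′∈Pj , m∈ , e∈Pm ,
         (x , x∈ , subst (b I x ℕ.≤_) (sym ue′≡bj) bx≤bj) ,
         (y , y∈ , subst (ℕ._< b I y) (sym ue′≡bj) bj<by)

    belowTop : (Fin m → Bool) → ℕ → Fin m → Bool
    belowTop T'' hi i = T'' i ∧ not (b I i ≡ᵇ hi)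

    -- If T'' ⊆ T* has more than k + 1/δ tasks, then more than k of them have a bottleneck
    -- capacity other than b(x): at most 1/δ share the bottleneck edge of x.
    many-belowTop : ∀ T'' x → (∀ i → T'' i ≡ true → Tstar i ≡ true) →
      ℕ→ℚ k + 1/δ < ℕ→ℚ (card T'') → k ℕ.< card (belowTop T'' (b I x))
    many-belowTop T'' x T''⊆T* big = ℕP.≰⇒> λ R≤k → QP.<-irrefl refl (QP.<-≤-trans big (T''≤ R≤k))
      where
      e* : ℕ
      e* = proj₁ (bottleneck x)
      e*∈Px : inP I x e* ≡ true
      e*∈Px = proj₁ (proj₂ (bottleneck x))
      ue*≡bx : u e* ≡ b I x
      ue*≡bx = proj₂ (proj₂ (bottleneck x))
      atTop : Fin m → Bool
      atTop i = T'' i ∧ (b I i ≡ᵇ b I x)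
      atTop≤1/δ : ℕ→ℚ (card atTop) ≤ 1/δ
      atTop≤1/δ = sameBottleneck≤inv δ δpos large Tstar feasT atTop e* (inP-edge x e* e*∈Px)
        λ i i∈ → T''⊆T* i (∧-elimˡ i∈) , trans (≡ᵇ⇒≡ (∧-elimʳ {T'' i} i∈)) (sym ue*≡bx)
      T''≤ : card (belowTop T'' (b I x)) ℕ.≤ k → ℕ→ℚ (card T'') ≤ ℕ→ℚ k + 1/δ
      T''≤ R≤k = begin
        ℕ→ℚ (card T'')
          ≡⟨ cong ℕ→ℚ (card-split T'' (λ i → b I i ≡ᵇ b I x)) ⟩
        ℕ→ℚ (card atTop ℕ.+ card (belowTop T'' (b I x)))
          ≡⟨ ℕ→ℚ-+ (card atTop) _ ⟩
        ℕ→ℚ (card atTop) + ℕ→ℚ (card (belowTop T'' (b I x)))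
          ≤⟨ QP.+-mono-≤ atTop≤1/δ (ℕ→ℚ-mono-≤ R≤k) ⟩
        1/δ + ℕ→ℚ k
          ≡⟨ QP.+-comm 1/δ (ℕ→ℚ k) ⟩
        ℕ→ℚ k + 1/δ ∎
        where open QP.≤-Reasoning

    -- Thinness: pick x, y ∈ T'' of minimal and maximal capacity and probe between them.
    maze-thin : MazeThin I (ℕ→ℚ k + 1/δ) Tstar L'
    maze-thin e e-edge T'' T''⊆ big = extremes (argMin T'' (b I)) (argMax T'' (b I))
      where
      nonempty : (∀ z → T'' z ≡ false) → MazeWitness e T''
      nonempty empty = ⊥-elim (QP.<-irrefl refl
        (QP.<-≤-trans big (subst (λ c → ℕ→ℚ c ≤ ℕ→ℚ k + 1/δ) (sym (card-empty T'' empty)) 0≤k+1/δ)))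
      T''⊆T* : ∀ i → T'' i ≡ true → Tstar i ≡ true
      T''⊆T* i i∈ = ∧-elimˡ (proj₁ (T''⊆ i i∈))
      -- With lo = b(x) and hi = b(y) the extreme capacities on T'', every task of
      -- belowTop T'' hi crosses the probe at e, and there are more than k of them.
      extremes : ∀ {mlo mhi} → Best T'' (λ x z → b I x ℕ.≤ b I z) mlo →
        Best T'' (λ y z → b I z ℕ.≤ b I y) mhi → MazeWitness e T''
      extremes (none empty) _ = nonempty empty
      extremes (some _ _) (none empty) = nonempty empty
      extremes (some {x} x∈ lowest) (some {y} y∈ highest) =
        let j , j∈L' , j-hit = L'-thin (ℕ→ℚ e + ½) (justBelow (b I x)) (ℕ→ℚ (b I y))
              (ℕP.<-≤-trans (many-belowTop T'' y T''⊆T* big) (card-mono _ _ crosses))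
            e∈Pj , bx≤bj , bj<by = probe-elim e (b I x) (b I y) j j-hit
        in witness-from-L' e T'' j x y j∈L' e∈Pj x∈ bx≤bj y∈ bj<by
        where
        crosses : ∀ i → belowTop T'' (b I y) i ≡ true → Tstar i ∧ probe e (b I x) (b I y) i ≡ true
        crosses i i∈ = ∧-intro (T''⊆T* i i∈T'') (probe-intro e (b I x) (b I y) i
          (proj₂ (T''⊆ i i∈T'')) (lowest i i∈T'')
          (ℕP.≤∧≢⇒< (highest i i∈T'') λ bi≡by → not-true⇒false (∧-elimʳ {T'' i} i∈) (≡⇒≡ᵇ bi≡by)))
          where
          i∈T'' : T'' i ≡ true
          i∈T'' = ∧-elimˡ i∈

lemma10 : (I : UFP) → Standing I →
    (δ : ℚ) → (δpos : Positive δ) → δ ≤ 1ℚ → DeltaLarge I δ →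
    (Tstar : Fin (UFP.m I) → Bool) → Optimal I Tstar →
    (k : ℕ) → (L' : Fin (UFP.m I) → Bool) →
    (∀ i → L' i ≡ true → Tstar i ≡ true) →
    SegThin I k Tstar L' →
    MazeThin I (ℕ→ℚ k + inv δ δpos) Tstar L'
      × (∀ e → IsEdge I e → demandOn I (TL I Tstar L') e + mDemandOn I δ L' e ≤ ℕ→ℚ (UFP.u I e))
lemma10 I standing δ δpos _ large Tstar (feasT , _) k L' L'⊆T* L'-thin =
  Thinness.maze-thin I standing δ δpos large Tstar feasT k L' L'-thin ,
  maze-feasible I standing δ large Tstar L' feasT L'⊆T*
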